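{- Let $\pi\in B_n$ and $k\in[n]$. In the full pignose diagram of $\pi$, call an arc "cut" by a pignose if one endpoint of the arc is at or to the left of the pignose's left vertex and the other endpoint is at or to the right of its right vertex. Then the number of upper arcs cut by the pignose labeled $-k$ equals the number of lower arcs cut by it minus $1$, and the number of upper arcs cut by the pignose labeled $k$ equals the number of lower arcs cut by it plus $1$.
   Context: $B_n$ is the set of signed permutations of $[n]$; $\pi\in B_n$ is viewed as a bijection of $[\pm n]$ with $\pi(i)=\pi_i$, $\pi(-i)=-\pi_i$ for $i\in[n]$. Full pignose diagram: place $2n$ pignoses on a horizontal line, labeled $-n,\dots,-1,1,\dots,n$ from left to right, each consisting of two consecutive vertices. For a pignose labeled $i>0$ its first vertex is its left vertex and its second vertex its right vertex; for $i<0$ its first vertex is its right vertex and its second vertex its left vertex. For each $i\in[\pm n]$ an arc joins the first vertex of pignose $i$ to the second vertex of pignose $\pi(i)$; it is an upper arc (drawn above the line) if the second-vertex endpoint lies to the right of the first-vertex endpoint, and a lower arc otherwise. -}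

module Defs where

open import Data.Nat using (ℕ; suc)
open import Data.Integer as ℤ using (ℤ; +_; -_; _≤_; _<_; _*_; _+_)
import Data.Integer.Properties as ℤP
open import Data.Fin using (Fin; toℕ)
open import Data.Fin.Permutation using (Permutation′; _⟨$⟩ʳ_)
open import Data.Bool using (Bool; true; false; _xor_)
open import Data.Product using (_×_; _,_)
open import Data.Sum using (_⊎_)
open import Data.List using (List; length; filter; allFin; map; concatMap; _∷_; [])
open import Relation.Nullary using (Dec)
open import Relation.Nullary.Decidable using (_×-dec_; _⊎-dec_)

-- A signed permutation of [n]: an underlying permutation σ of [n] together
-- with a sign for each i.  π(i) = σ(i) if neg i = false, and π(i) = -σ(i)
-- if neg i = true.
record SignedPerm (n : ℕ) : Set where
  field
    σ   : Permutation′ n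
    neg : Fin n → Bool

open SignedPerm public

-- Elements of [±n]: (i , false) stands for the label +(i+1),
-- (i , true) stands for the label -(i+1).
SignedLabel : ℕ → Set
SignedLabel n = Fin n × Bool

allLabels : (n : ℕ) → List (SignedLabel n)
allLabels n = concatMap (λ i → (i , true) ∷ (i , false) ∷ []) (allFin n)

labelValue : {n : ℕ} → SignedLabel n → ℤ
labelValue (i , false) = + suc (toℕ i)
labelValue (i , true)  = - (+ suc (toℕ i))

-- π as a bijection of [±n] with π(-i) = -π(i)
apply : {n : ℕ} → SignedPerm n → SignedLabel n → SignedLabel n
apply π (i , s) = (σ π ⟨$⟩ʳ i , s xor neg π i)

-- Vertex positions on the line: pignose with label value v has its left
-- vertex at 2v and its right vertex at 2v+1.  This respects the left-to-right
-- order of the pignoses -n, …, -1, 1, …, n.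
leftVertex : {n : ℕ} → SignedLabel n → ℤ
leftVertex x = + 2 * labelValue x

rightVertex : {n : ℕ} → SignedLabel n → ℤ
rightVertex x = leftVertex x + + 1

firstVertex : {n : ℕ} → SignedLabel n → ℤ
firstVertex (i , false) = leftVertex (i , false)
firstVertex (i , true)  = rightVertex (i , true)

secondVertex : {n : ℕ} → SignedLabel n → ℤ
secondVertex (i , false) = rightVertex (i , false)
secondVertex (i , true)  = leftVertex (i , true)

-- The arc indexed by x ∈ [±n] joins firstVertex x to secondVertex (π x).
arcStart : {n : ℕ} → SignedPerm n → SignedLabel n → ℤ
arcStart π x = firstVertex x

arcEnd : {n : ℕ} → SignedPerm n → SignedLabel n → ℤ
arcEnd π x = secondVertex (apply π x)

IsUpper : {n : ℕ} → SignedPerm n → SignedLabel n → Set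
IsUpper π x = arcStart π x < arcEnd π x

IsLower : {n : ℕ} → SignedPerm n → SignedLabel n → Set
IsLower π x = arcEnd π x ≤ arcStart π x

isUpper? : {n : ℕ} (π : SignedPerm n) (x : SignedLabel n) → Dec (IsUpper π x)
isUpper? π x = arcStart π x ℤP.<? arcEnd π x

isLower? : {n : ℕ} (π : SignedPerm n) (x : SignedLabel n) → Dec (IsLower π x)
isLower? π x = arcEnd π x ℤP.≤? arcStart π x

IsCut : {n : ℕ} → SignedPerm n → SignedLabel n → SignedLabel n → Set
IsCut π p x =
  (arcStart π x ≤ leftVertex p × rightVertex p ≤ arcEnd π x)
  ⊎ (arcEnd π x ≤ leftVertex p × rightVertex p ≤ arcStart π x)

isCut? : {n : ℕ} (π : SignedPerm n) (p x : SignedLabel n) → Dec (IsCut π p x)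
isCut? π p x =
  ((arcStart π x ℤP.≤? leftVertex p) ×-dec (rightVertex p ℤP.≤? arcEnd π x))
  ⊎-dec ((arcEnd π x ℤP.≤? leftVertex p) ×-dec (rightVertex p ℤP.≤? arcStart π x))

upperCut : {n : ℕ} → SignedPerm n → SignedLabel n → ℕ
upperCut {n} π p = length (filter (λ x → isUpper? π x ×-dec isCut? π p x) (allLabels n))

lowerCut : {n : ℕ} → SignedPerm n → SignedLabel n → ℕ
lowerCut {n} π p = length (filter (λ x → isLower? π x ×-dec isCut? π p x) (allLabels n))

-- Write c for the left vertex of the pignose p, so that its right vertex is c + 1.  An arc is
-- cut by p exactly when one endpoint is ≤ c and the other is > c, and it is upper or lower
-- according to which of its two endpoints is the small one.  Hence, arc by arc,
--   [upper and cut] + [end ≤ c] = [lower and cut] + [start ≤ c],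
-- and summing over all arcs, U − L = #{first vertices ≤ c} − #{second vertices ≤ c}, because
-- π permutes the second vertices.  Both vertices of every pignose other than p lie on the
-- same side of c, while p itself has its left vertex ≤ c and its right vertex > c; so the
-- difference is +1 when the left vertex of p is its first vertex (p > 0) and −1 otherwise.
module Submission where

open import Defs
open import Data.Nat using (ℕ; _+_)
open import Data.Fin using (Fin)
open import Data.Bool using (true; false)
open import Data.Product using (_×_; _,_)
open import Relation.Binary.PropositionalEquality using (_≡_)

open import Level using (Level)
open import Data.Nat using (zero; suc)
open import Data.Nat.Properties
  using (suc-injective; +-cancelʳ-≡; +-identityʳ; +-comm; +-assoc; +-0-commutativeMonoid; +-commutativeSemigroup)
open import Data.Integer as ℤ using (ℤ; 1ℤ)
open import Data.Integer.Properties as ℤP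
  using (_≤?_; ≤-refl; <⇒≤; <⇒≱; <-asym; <-irrefl; ≤-<-trans; ≰⇒>; ≤∧≢⇒<)
import Data.Fin as Fin
import Data.Fin.Properties as Fin
import Data.Bool.Properties as Bool
open import Data.Fin.Permutation using (_⟨$⟩ʳ_)
open import Data.Product using (proj₁; proj₂)
open import Data.Product.Properties using (≡-dec)
open import Data.Sum using (_⊎_; inj₁; inj₂)
open import Data.List using (List; []; _∷_; length; filter; tabulate; concatMap)
open import Function using (_∘_; _⇔_; mk⇔; Equivalence)
open import Function.Properties.Equivalence using () renaming (trans to ⇔-trans)
open import Relation.Nullary using (Dec; yes; no; ¬_; contradiction)
open import Relation.Nullary.Decidable using (_×-dec_; ¬?)
open import Relation.Unary using (Pred; Decidable)
open import Relation.Binary.Definitions using (DecidableEquality)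
open import Relation.Binary.PropositionalEquality
  using (_≢_; refl; sym; trans; cong; cong₂; subst; _≗_; module ≡-Reasoning)
open import Algebra.Properties.CommutativeMonoid.Sum +-0-commutativeMonoid
  using (sum-syntax; sum-cong-≗; ∑-distrib-+; sum-permute; sum-remove; sum-replicate-zero)
open import Algebra.Properties.CommutativeSemigroup +-commutativeSemigroup
  using (interchange; x∙yz≈xz∙y)

open ≡-Reasoning

private variable
  a b : Level
  A B : Set a
  n : ℕ

𝟙 : Dec A → ℕ
𝟙 (yes _) = 1
𝟙 (no _)  = 0

𝟙-yes : (d : Dec A) → A → 𝟙 d ≡ 1
𝟙-yes (yes _) _ = refl
𝟙-yes (no ¬x) x = contradiction x ¬x

𝟙-no : (d : Dec A) → ¬ A → 𝟙 d ≡ 0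
𝟙-no (yes x) ¬x = contradiction x ¬x
𝟙-no (no _)  _  = refl

𝟙-cong : (d : Dec A) (e : Dec B) → A ⇔ B → 𝟙 d ≡ 𝟙 e
𝟙-cong (yes _)  (yes _)  A⇔B = refl
𝟙-cong (yes x)  (no ¬y)  A⇔B = contradiction (Equivalence.to A⇔B x) ¬y
𝟙-cong (no ¬x)  (yes y)  A⇔B = contradiction (Equivalence.from A⇔B y) ¬x
𝟙-cong (no _)   (no _)   A⇔B = refl

𝟙[a×¬b]+𝟙[b]≡𝟙[b×¬a]+𝟙[a] : (a : Dec A) (b : Dec B) →
  𝟙 (a ×-dec ¬? b) + 𝟙 b ≡ 𝟙 (b ×-dec ¬? a) + 𝟙 a
𝟙[a×¬b]+𝟙[b]≡𝟙[b×¬a]+𝟙[a] (yes _) (yes _) = refl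
𝟙[a×¬b]+𝟙[b]≡𝟙[b×¬a]+𝟙[a] (yes _) (no _)  = refl
𝟙[a×¬b]+𝟙[b]≡𝟙[b×¬a]+𝟙[a] (no _)  (yes _) = refl
𝟙[a×¬b]+𝟙[b]≡𝟙[b×¬a]+𝟙[a] (no _)  (no _)  = refl

∑-δ : (k : Fin n) → ∑[ i < n ] 𝟙 (i Fin.≟ k) ≡ 1
∑-δ {suc n} k = begin
  ∑[ i < suc n ] δ i                       ≡⟨ sum-remove δ ⟩
  δ k + ∑[ j < n ] δ (Fin.punchIn k j)     ≡⟨ cong₂ _+_ (𝟙-yes _ refl) (sum-cong-≗ off-diagonal) ⟩
  1 + ∑[ j < n ] 0                         ≡⟨ cong (1 +_) (sum-replicate-zero n) ⟩
  1                                        ∎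
  where
  δ : Fin (suc n) → ℕ
  δ i = 𝟙 (i Fin.≟ k)

  off-diagonal : ∀ j → δ (Fin.punchIn k j) ≡ 0
  off-diagonal j = 𝟙-no _ (Fin.punchInᵢ≢i k j)

∑± : (SignedLabel n → ℕ) → ℕ
∑± {n} f = ∑[ i < n ] (f (i , true) + f (i , false))

∑±-cong : {f g : SignedLabel n → ℕ} → f ≗ g → ∑± f ≡ ∑± g
∑±-cong {n} f≗g = sum-cong-≗ {n} (λ i → cong₂ _+_ (f≗g (i , true)) (f≗g (i , false)))

∑±-distrib-+ : (f g : SignedLabel n → ℕ) → ∑± (λ y → f y + g y) ≡ ∑± f + ∑± g
∑±-distrib-+ {n} f g =
  trans (sum-cong-≗ {n} (λ i → interchange (f (i , true)) (g (i , true)) (f (i , false)) (g (i , false))))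
        (∑-distrib-+ f′ g′)
  where
  f′ g′ : Fin n → ℕ
  f′ i = f (i , true) + f (i , false)
  g′ i = g (i , true) + g (i , false)

∑±-apply : (π : SignedPerm n) (f : SignedLabel n → ℕ) → ∑± (f ∘ apply π) ≡ ∑± f
∑±-apply {n} π f = begin
  ∑± (f ∘ apply π)                     ≡⟨ sum-cong-≗ pair-apply ⟩
  ∑[ i < n ] pair (σ π ⟨$⟩ʳ i)          ≡⟨ sum-permute pair (σ π) ⟨
  ∑± f                                 ∎
  where
  pair : Fin n → ℕ
  pair j = f (j , true) + f (j , false)

  pair-apply : ∀ i → f (apply π (i , true)) + f (apply π (i , false)) ≡ pair (σ π ⟨$⟩ʳ i)
  pair-apply i with neg π i
  ... | false = refl
  ... | true  = +-comm (f (σ π ⟨$⟩ʳ i , false)) (f (σ π ⟨$⟩ʳ i , true))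

_≟±_ : DecidableEquality (SignedLabel n)
_≟±_ = ≡-dec Fin._≟_ Bool._≟_

∑±-δ : (q : SignedLabel n) → ∑± (λ y → 𝟙 (y ≟± q)) ≡ 1
∑±-δ (k , s) = trans (sum-cong-≗ (pair-δ s)) (∑-δ k)
  where
  same-sign : ∀ s i → 𝟙 ((i , s) ≟± (k , s)) ≡ 𝟙 (i Fin.≟ k)
  same-sign s i = 𝟙-cong ((i , s) ≟± (k , s)) (i Fin.≟ k) (mk⇔ (cong proj₁) (cong (_, s)))

  pair-δ : ∀ s i → 𝟙 ((i , true) ≟± (k , s)) + 𝟙 ((i , false) ≟± (k , s)) ≡ 𝟙 (i Fin.≟ k)
  pair-δ true  i = trans (cong₂ _+_ (same-sign true i) (𝟙-no ((i , false) ≟± (k , true)) λ ()))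
                         (+-identityʳ _)
  pair-δ false i = cong₂ _+_ (𝟙-no ((i , true) ≟± (k , false)) λ ()) (same-sign false i)

length-filter-∷ : {P : Pred A b} (P? : Decidable P) (x : A) (xs : List A) →
  length (filter P? (x ∷ xs)) ≡ 𝟙 (P? x) + length (filter P? xs)
length-filter-∷ P? x xs with P? x
... | yes _ = refl
... | no _  = refl

length-filter-allLabels : {P : Pred (SignedLabel n) b} (P? : Decidable P) →
  length (filter P? (allLabels n)) ≡ ∑± (𝟙 ∘ P?)
length-filter-allLabels {n} P? = over-tabulate (λ i → i)
  where
  labels : List (Fin n) → List (SignedLabel n)
  labels = concatMap (λ i → (i , true) ∷ (i , false) ∷ [])

  over-tabulate : ∀ {m} (f : Fin m → Fin n) →
    length (filter P? (labels (tabulate f))) ≡ ∑[ j < m ] (𝟙 (P? (f j , true)) + 𝟙 (P? (f j , false)))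
  over-tabulate {zero}  f = refl
  over-tabulate {suc m} f = begin
    length (filter P? (x ∷ y ∷ rest))                ≡⟨ length-filter-∷ P? x (y ∷ rest) ⟩
    𝟙 (P? x) + length (filter P? (y ∷ rest))         ≡⟨ cong (𝟙 (P? x) +_) (length-filter-∷ P? y rest) ⟩
    𝟙 (P? x) + (𝟙 (P? y) + length (filter P? rest))  ≡⟨ +-assoc (𝟙 (P? x)) _ _ ⟨
    𝟙 (P? x) + 𝟙 (P? y) + length (filter P? rest)    ≡⟨ cong (𝟙 (P? x) + 𝟙 (P? y) +_) (over-tabulate (f ∘ Fin.suc)) ⟩
    ∑[ j < suc m ] (𝟙 (P? (f j , true)) + 𝟙 (P? (f j , false)))  ∎
    where
    x y : SignedLabel n
    x = f Fin.zero , true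
    y = f Fin.zero , false
    rest : List (SignedLabel n)
    rest = labels (tabulate (f ∘ Fin.suc))

<⇒+1≤ : {x y : ℤ} → x ℤ.< y → x ℤ.+ 1ℤ ℤ.≤ y
<⇒+1≤ {x} x<y = subst (ℤ._≤ _) (ℤP.+-comm 1ℤ x) (ℤP.i<j⇒suc[i]≤j x<y)

+1≤⇒< : {x y : ℤ} → x ℤ.+ 1ℤ ℤ.≤ y → x ℤ.< y
+1≤⇒< {x} x+1≤y = ℤP.suc[i]≤j⇒i<j (subst (ℤ._≤ _) (ℤP.+-comm x 1ℤ) x+1≤y)

Straddles : ℤ → ℤ → ℤ → Set
Straddles c a b = a ℤ.≤ c × c ℤ.+ 1ℤ ℤ.≤ b

-- IsCut π p x unfolds to Crosses (leftVertex p) (arcStart π x) (arcEnd π x).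
Crosses : ℤ → ℤ → ℤ → Set
Crosses c s e = Straddles c s e ⊎ Straddles c e s

module _ {c : ℤ} where

  straddles⇒< : {a b : ℤ} → Straddles c a b → a ℤ.< b
  straddles⇒< (a≤c , c+1≤b) = ≤-<-trans a≤c (+1≤⇒< c+1≤b)

  straddles⇔ : {a b : ℤ} → Straddles c a b ⇔ (a ℤ.≤ c × ¬ b ℤ.≤ c)
  straddles⇔ = mk⇔ (λ (a≤c , c+1≤b) → a≤c , <⇒≱ (+1≤⇒< c+1≤b))
                   (λ (a≤c , b≰c) → a≤c , <⇒+1≤ (≰⇒> b≰c))

  upper-crosses⇔ : {s e : ℤ} → (s ℤ.< e × Crosses c s e) ⇔ Straddles c s e
  upper-crosses⇔ = mk⇔ (λ { (_   , inj₁ st) → st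
                           ; (s<e , inj₂ st) → contradiction (straddles⇒< st) (<-asym s<e) })
                       (λ st → straddles⇒< st , inj₁ st)

  lower-crosses⇔ : {s e : ℤ} → (e ℤ.≤ s × Crosses c s e) ⇔ Straddles c e s
  lower-crosses⇔ = mk⇔ (λ { (e≤s , inj₁ st) → contradiction e≤s (<⇒≱ (straddles⇒< st))
                           ; (_   , inj₂ st) → st })
                       (λ st → <⇒≤ (straddles⇒< st) , inj₂ st)

crossing-balance : (c s e : ℤ) (u : Dec (s ℤ.< e × Crosses c s e))
                   (l : Dec (e ℤ.≤ s × Crosses c s e)) →
  𝟙 u + 𝟙 (e ≤? c) ≡ 𝟙 l + 𝟙 (s ≤? c)
crossing-balance c s e u l = begin
  𝟙 u + 𝟙 (e ≤? c)
    ≡⟨ cong (_+ 𝟙 (e ≤? c)) (𝟙-cong u s×¬e (⇔-trans upper-crosses⇔ straddles⇔)) ⟩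
  𝟙 s×¬e + 𝟙 (e ≤? c)
    ≡⟨ 𝟙[a×¬b]+𝟙[b]≡𝟙[b×¬a]+𝟙[a] (s ≤? c) (e ≤? c) ⟩
  𝟙 e×¬s + 𝟙 (s ≤? c)
    ≡⟨ cong (_+ 𝟙 (s ≤? c)) (𝟙-cong l e×¬s (⇔-trans lower-crosses⇔ straddles⇔)) ⟨
  𝟙 l + 𝟙 (s ≤? c)
    ∎
  where
  s×¬e : Dec (s ℤ.≤ c × ¬ e ℤ.≤ c)
  s×¬e = s ≤? c ×-dec ¬? (e ≤? c)
  e×¬s : Dec (e ℤ.≤ c × ¬ s ℤ.≤ c)
  e×¬s = e ≤? c ×-dec ¬? (s ≤? c)

𝟙[x≤z]≡𝟙[x+1≤z]+𝟙[x≡z] : (x z : ℤ) → 𝟙 (x ≤? z) ≡ 𝟙 (x ℤ.+ 1ℤ ≤? z) + 𝟙 (x ℤ.≟ z)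
𝟙[x≤z]≡𝟙[x+1≤z]+𝟙[x≡z] x z with x ℤ.≟ z
... | yes refl = trans (𝟙-yes (x ≤? x) ≤-refl)
                       (cong (_+ 1) (sym (𝟙-no (x ℤ.+ 1ℤ ≤? x) (<-irrefl refl ∘ +1≤⇒<))))
... | no x≢z   = trans (𝟙-cong (x ≤? z) (x ℤ.+ 1ℤ ≤? z)
                               (mk⇔ (λ x≤z → <⇒+1≤ (≤∧≢⇒< x≤z x≢z)) (<⇒≤ ∘ +1≤⇒<)))
                       (sym (+-identityʳ _))

labelValue-injective : {x y : SignedLabel n} → labelValue x ≡ labelValue y → x ≡ y
labelValue-injective {x = _ , false} {_ , false} eq =
  cong (_, false) (Fin.toℕ-injective (suc-injective (ℤP.+-injective eq)))
labelValue-injective {x = _ , true}  {_ , true}  eq =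
  cong (_, true) (Fin.toℕ-injective (ℤP.-[1+-injective eq))
labelValue-injective {x = _ , false} {_ , true}  ()
labelValue-injective {x = _ , true}  {_ , false} ()

leftVertex-injective : {x y : SignedLabel n} → leftVertex x ≡ leftVertex y → x ≡ y
leftVertex-injective {x = x} {y} = labelValue-injective ∘ ℤP.*-cancelˡ-≡ (ℤ.+ 2) (labelValue x) (labelValue y)

𝟙[left≤c]≡𝟙[right≤c]+𝟙[≡p] : (y p : SignedLabel n) →
  𝟙 (leftVertex y ≤? leftVertex p) ≡ 𝟙 (rightVertex y ≤? leftVertex p) + 𝟙 (y ≟± p)
𝟙[left≤c]≡𝟙[right≤c]+𝟙[≡p] y p =
  trans (𝟙[x≤z]≡𝟙[x+1≤z]+𝟙[x≡z] (leftVertex y) (leftVertex p))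
        (cong (𝟙 (rightVertex y ≤? leftVertex p) +_)
              (𝟙-cong (leftVertex y ℤ.≟ leftVertex p) (y ≟± p) (mk⇔ leftVertex-injective (cong leftVertex))))

𝟙[right≤c]≡𝟙[left≤c]+𝟙[≡p] : (y p : SignedLabel n) → proj₂ y ≢ proj₂ p →
  𝟙 (rightVertex y ≤? leftVertex p) ≡ 𝟙 (leftVertex y ≤? leftVertex p) + 𝟙 (y ≟± p)
𝟙[right≤c]≡𝟙[left≤c]+𝟙[≡p] y p sign≢ = begin
  𝟙 right                  ≡⟨ +-identityʳ _ ⟨
  𝟙 right + 0              ≡⟨ cong (𝟙 right +_) y≢p ⟨
  𝟙 right + 𝟙 (y ≟± p)     ≡⟨ 𝟙[left≤c]≡𝟙[right≤c]+𝟙[≡p] y p ⟨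
  𝟙 left                   ≡⟨ +-identityʳ _ ⟨
  𝟙 left + 0               ≡⟨ cong (𝟙 left +_) y≢p ⟨
  𝟙 left + 𝟙 (y ≟± p)      ∎
  where
  left : Dec (leftVertex y ℤ.≤ leftVertex p)
  left = leftVertex y ≤? leftVertex p
  right : Dec (rightVertex y ℤ.≤ leftVertex p)
  right = rightVertex y ≤? leftVertex p

  y≢p : 𝟙 (y ≟± p) ≡ 0
  y≢p = 𝟙-no (y ≟± p) (sign≢ ∘ cong proj₂)

below : (SignedLabel n → ℤ) → SignedLabel n → SignedLabel n → ℕ
below v p y = 𝟙 (v y ≤? leftVertex p)

#[_≤_] : (SignedLabel n → ℤ) → SignedLabel n → ℕ
#[ v ≤ p ] = ∑± (below v p)

∑±-+δ : (p : SignedLabel n) (f g : SignedLabel n → ℕ) →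
  (∀ y → f y ≡ g y + 𝟙 (y ≟± p)) → ∑± f ≡ ∑± g + 1
∑±-+δ p f g f≗g+δ = begin
  ∑± f                                    ≡⟨ ∑±-cong f≗g+δ ⟩
  ∑± (λ y → g y + 𝟙 (y ≟± p))             ≡⟨ ∑±-distrib-+ g (λ y → 𝟙 (y ≟± p)) ⟩
  ∑± g + ∑± (λ y → 𝟙 (y ≟± p))            ≡⟨ cong (∑± g +_) (∑±-δ p) ⟩
  ∑± g + 1                                ∎

#first≡#second+1 : (k : Fin n) →
  #[ firstVertex ≤ (k , false) ] ≡ #[ secondVertex ≤ (k , false) ] + 1
#first≡#second+1 k =
  ∑±-+δ (k , false) (below firstVertex (k , false)) (below secondVertex (k , false)) λ where
    (i , false) → 𝟙[left≤c]≡𝟙[right≤c]+𝟙[≡p] (i , false) (k , false)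
    (i , true)  → 𝟙[right≤c]≡𝟙[left≤c]+𝟙[≡p] (i , true) (k , false) λ ()

#second≡#first+1 : (k : Fin n) →
  #[ secondVertex ≤ (k , true) ] ≡ #[ firstVertex ≤ (k , true) ] + 1
#second≡#first+1 k =
  ∑±-+δ (k , true) (below secondVertex (k , true)) (below firstVertex (k , true)) λ where
    (i , true)  → 𝟙[left≤c]≡𝟙[right≤c]+𝟙[≡p] (i , true) (k , true)
    (i , false) → 𝟙[right≤c]≡𝟙[left≤c]+𝟙[≡p] (i , false) (k , true) λ ()

arc-balance : (π : SignedPerm n) (p : SignedLabel n) →
  upperCut π p + #[ secondVertex ≤ p ] ≡ lowerCut π p + #[ firstVertex ≤ p ]
arc-balance π p = begin
  upperCut π p + #[ secondVertex ≤ p ]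
    ≡⟨ cong₂ _+_ (length-filter-allLabels upper?) (sym (∑±-apply π (below secondVertex p))) ⟩
  ∑± (𝟙 ∘ upper?) + ∑± (below secondVertex p ∘ apply π)
    ≡⟨ ∑±-distrib-+ (𝟙 ∘ upper?) (below secondVertex p ∘ apply π) ⟨
  ∑± (λ x → 𝟙 (upper? x) + 𝟙 (arcEnd π x ≤? c))
    ≡⟨ ∑±-cong (λ x → crossing-balance c (arcStart π x) (arcEnd π x) (upper? x) (lower? x)) ⟩
  ∑± (λ x → 𝟙 (lower? x) + below firstVertex p x)
    ≡⟨ ∑±-distrib-+ (𝟙 ∘ lower?) (below firstVertex p) ⟩
  ∑± (𝟙 ∘ lower?) + #[ firstVertex ≤ p ]
    ≡⟨ cong (_+ #[ firstVertex ≤ p ]) (length-filter-allLabels lower?) ⟨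
  lowerCut π p + #[ firstVertex ≤ p ]
    ∎
  where
  c : ℤ
  c = leftVertex p

  upper? : Decidable (λ x → IsUpper π x × IsCut π p x)
  upper? x = isUpper? π x ×-dec isCut? π p x
  lower? : Decidable (λ x → IsLower π x × IsCut π p x)
  lower? x = isLower? π x ×-dec isCut? π p x

lemma4p2 : (n : ℕ) (π : SignedPerm n) (k : Fin n) →
    (upperCut π (k , true) + 1 ≡ lowerCut π (k , true))
    × (upperCut π (k , false) ≡ lowerCut π (k , false) + 1)
lemma4p2 n π k = negative , positive
  where
  negative : upperCut π (k , true) + 1 ≡ lowerCut π (k , true)
  negative = +-cancelʳ-≡ #first _ _ (begin
    upperCut π (k , true) + 1 + #first                     ≡⟨ x∙yz≈xz∙y (upperCut π (k , true)) #first 1 ⟨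
    upperCut π (k , true) + (#first + 1)                   ≡⟨ cong (upperCut π (k , true) +_) (#second≡#first+1 k) ⟨
    upperCut π (k , true) + #[ secondVertex ≤ (k , true) ] ≡⟨ arc-balance π (k , true) ⟩
    lowerCut π (k , true) + #first                         ∎)
    where
    #first : ℕ
    #first = #[ firstVertex ≤ (k , true) ]

  positive : upperCut π (k , false) ≡ lowerCut π (k , false) + 1
  positive = +-cancelʳ-≡ #second _ _ (begin
    upperCut π (k , false) + #second                        ≡⟨ arc-balance π (k , false) ⟩
    lowerCut π (k , false) + #[ firstVertex ≤ (k , false) ] ≡⟨ cong (lowerCut π (k , false) +_) (#first≡#second+1 k) ⟩
    lowerCut π (k , false) + (#second + 1)                  ≡⟨ x∙yz≈xz∙y (lowerCut π (k , false)) #second 1 ⟩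
    lowerCut π (k , false) + 1 + #second                    ∎)
    where
    #second : ℕ
    #second = #[ secondVertex ≤ (k , false) ]
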